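{- In NLML, define for sorts $\tau$ and name sort $\alpha$ the pattern $fresh_{\tau;\alpha}(x) := \exists a{:}\alpha.\ a \wedge \lceil a\mathrel{\#}x\rceil$ (for $x$ of sort $\tau$). Then the following are valid in every model of $Ax_{NLML}$: (F1') $(fresh(x)\ fresh(x))\cdot x = x$; (F2') $fresh_{\alpha;\alpha}(a{:}\alpha) = \neg a$; (F3') $fresh_{\alpha;\alpha'}(a{:}\alpha) = \top_{\alpha'}$ for distinct name sorts $\alpha\neq\alpha'$; (F4') $\forall x{:}\tau.\exists a{:}\alpha.\ a\in fresh(x)$ (where $a\in\phi$ abbreviates $(a\vee\phi)=\phi$). Conversely, axioms (F1)–(F4) are provable from (F1')–(F4').
   Context: Matching logic: a signature has sorts (closed under finite products, containing $Pred$), variables, and symbols $\sigma \in \Sigma_{\tau_1,\dots,\tau_n;\tau}$. Patterns: $x \mid \phi\wedge\psi \mid \neg\phi \mid \exists x.\phi \mid \sigma(\phi_1,\dots,\phi_n)$. A model gives nonempty carriers $M_\tau$ ($M_{Pred}=\{\star\}$) and maps $\sigma_M: M_{\tau_1}\times\cdots\times M_{\tau_n}\to\mathcal{P}(M_\tau)$; under a valuation, variables denote singletons, $\wedge$ is intersection, $\neg$ complement, $\exists$ union over values, and symbols act on sets by pointwise extension $\bigcup\{\sigma_M(v_1,\dots,v_n)\mid v_i\in[\![\phi_i]\!]\}$. The coercion $\lceil\cdot\rceil$ from $Pred$ to $\tau$ maps $\star$ to $M_\tau$; $\phi=\psi$ (sort $Pred$) denotes $\{\star\}$ iff both sides have the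 same denotation, else $\emptyset$. $\vee,\Rightarrow,\Leftrightarrow,\forall,\top,\bot$ are abbreviations. Validity: denoting the whole carrier under every valuation. NLML: from a nominal logic signature (name sorts $\alpha$, abstraction sorts $[\alpha]\tau$, swapping $(a\ a')\cdot x$, abstraction $[a]x$, freshness relation $a\mathrel{\#}x$ with result sort $Pred$, other function, constant and relation symbols), with axioms $Ax_{NLML}$ (free variables universally quantified): (S1) $(a\ a)\cdot x = x$; (S2) $(a\ a')\cdot((a\ a')\cdot x)=x$; (S3) $(a\ a')\cdot a = a'$; (EV) $(a\ b)\cdot\sigma(\vec{x}) = \sigma((a\ b)\cdot\vec{x})$ for every symbol $\sigma$; (P) $\forall x{:}Pred.\ x=\top_{Pred}$; (F1) $a\mathrel{\#}x\wedge a'\mathrel{\#}x \Rightarrow (a\ a')\cdot x = x$; (F2) $a\mathrel{\#}a' \Leftrightarrow a\neq a'$ (same name sort); (F3) $\forall a{:}\alpha,a'{:}\alpha'.\ a\mathrel{\#}a'$ for $\alpha\neq\alpha'$; (F4) $\forall\vec{x}.\exists a.\ a\mathrel{\#}\vec{x}$ (for any finite tuple $\vec x$); (A1) $[a]x=[a']x' \Leftrightarrow (a=a'\wedge x=x')\vee(a\mathrel{\#}x'\wedge (a\ a')\cdot x = x')$; (A2) $\forall x{:}[\alpha]\tau.\exists a,y.\ x=[a]y$; $(Fun_c)$ $\exists x.\ c=x$; $(Fun_f)$ $\forall\vec{z}.\exists x.\ f(\vec{z})=x$ for constants $c$ and function symbols $f$. -}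

module Defs where

open import Level using (0ℓ)
open import Data.Nat using (ℕ; zero; suc)
import Data.Nat as Nat
open import Data.List using (List; []; _∷_)
open import Data.Product using (Σ; _×_; _,_)
open import Data.Sum using (_⊎_)
open import Data.Unit using (⊤; tt)
open import Relation.Nullary using (¬_; Dec; yes; no)
open import Relation.Binary.PropositionalEquality using (_≡_; refl)
open import Relation.Binary.Definitions using (DecidableEquality)

-- Sorts of a nominal logic signature:
--   Pred, name sorts α, data (base) sorts δ, abstraction sorts [α]τ,
--   and finite (binary, hence all finite) products τ ⊗ τ'.

data Sort (NS DS : Set) : Set where
  pred : Sort NS DS
  nm   : NS → Sort NS DS
  dt   : DS → Sort NS DS
  abst : NS → Sort NS DS → Sort NS DS
  _⊗_  : Sort NS DS → Sort NS DS → Sort NS DS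

module _ {NS DS : Set} (eqN : DecidableEquality NS) (eqD : DecidableEquality DS) where

  sort-eq : DecidableEquality (Sort NS DS)
  sort-eq pred pred = yes refl
  sort-eq pred (nm _) = no λ ()
  sort-eq pred (dt _) = no λ ()
  sort-eq pred (abst _ _) = no λ ()
  sort-eq pred (_ ⊗ _) = no λ ()
  sort-eq (nm _) pred = no λ ()
  sort-eq (nm a) (nm b) with eqN a b
  ... | yes refl = yes refl
  ... | no ne = no λ { refl → ne refl }
  sort-eq (nm _) (dt _) = no λ ()
  sort-eq (nm _) (abst _ _) = no λ ()
  sort-eq (nm _) (_ ⊗ _) = no λ ()
  sort-eq (dt _) pred = no λ ()
  sort-eq (dt _) (nm _) = no λ ()
  sort-eq (dt a) (dt b) with eqD a b
  ... | yes refl = yes refl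
  ... | no ne = no λ { refl → ne refl }
  sort-eq (dt _) (abst _ _) = no λ ()
  sort-eq (dt _) (_ ⊗ _) = no λ ()
  sort-eq (abst _ _) pred = no λ ()
  sort-eq (abst _ _) (nm _) = no λ ()
  sort-eq (abst _ _) (dt _) = no λ ()
  sort-eq (abst a s) (abst b t) with eqN a b | sort-eq s t
  ... | yes refl | yes refl = yes refl
  ... | no ne | _ = no λ { refl → ne refl }
  ... | _ | no ne = no λ { refl → ne refl }
  sort-eq (abst _ _) (_ ⊗ _) = no λ ()
  sort-eq (_ ⊗ _) pred = no λ ()
  sort-eq (_ ⊗ _) (nm _) = no λ ()
  sort-eq (_ ⊗ _) (dt _) = no λ ()
  sort-eq (_ ⊗ _) (abst _ _) = no λ ()
  sort-eq (s ⊗ s') (t ⊗ t') with sort-eq s t | sort-eq s' t'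
  ... | yes refl | yes refl = yes refl
  ... | no ne | _ = no λ { refl → ne refl }
  ... | _ | no ne = no λ { refl → ne refl }

-- Swapping, abstraction and freshness are built in.

record Signature : Set₁ where
  field
    NSort : Set
    DSort : Set
    _≟N_  : DecidableEquality NSort
    _≟D_  : DecidableEquality DSort
    Fn    : List (Sort NSort DSort) → Sort NSort DSort → Set
    Cn    : Sort NSort DSort → Set
    Rel   : List (Sort NSort DSort) → Set

module NLML (sig : Signature) where
  open Signature sig public

  S : Set
  S = Sort NSort DSort

  _≟S_ : DecidableEquality S
  _≟S_ = sort-eq _≟N_ _≟D_

  data Sym : List S → S → Set where
    swapS  : (α : NSort) (τ : S) → Sym (nm α ∷ nm α ∷ τ ∷ []) τ
    absS   : (α : NSort) (τ : S) → Sym (nm α ∷ τ ∷ []) (abst α τ)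
    freshS : (α : NSort) (τ : S) → Sym (nm α ∷ τ ∷ []) pred
    fun    : ∀ {ss τ} → Fn ss τ → Sym ss τ
    con    : ∀ {τ} → Cn τ → Sym [] τ
    rel    : ∀ {ss} → Rel ss → Sym ss pred

  data IsFunction : ∀ {ss τ} → Sym ss τ → Set where
    isSwap : ∀ α τ → IsFunction (swapS α τ)
    isAbs  : ∀ α τ → IsFunction (absS α τ)
    isFun  : ∀ {ss τ} (f : Fn ss τ) → IsFunction (fun f)
    isCon  : ∀ {τ} (c : Cn τ) → IsFunction (con c)

  -- Patterns (sorted; variables are (sort, index) pairs)
  data Pat : S → Set
  data Pats : List S → Set

  data Pat where
    var   : ∀ {s} → ℕ → Pat s
    _∧ₚ_  : ∀ {s} → Pat s → Pat s → Pat s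
    ¬ₚ_   : ∀ {s} → Pat s → Pat s
    ∃ₚ    : ∀ {s} (t : S) → ℕ → Pat s → Pat s
    app   : ∀ {ss s} → Sym ss s → Pats ss → Pat s
    ⌈_⌉   : ∀ {s} → Pat pred → Pat s
    _≐_   : ∀ {s} → Pat s → Pat s → Pat pred

  data Pats where
    []  : Pats []
    _∷_ : ∀ {s ss} → Pat s → Pats ss → Pats (s ∷ ss)

  infixr 6 _∧ₚ_
  infixr 5 _∨ₚ_
  infixr 4 _⇒ₚ_
  infix 3 _⇔ₚ_
  infix 7 _≐_ _≠ₚ_ _∈ₚ_

  _∨ₚ_ : ∀ {s} → Pat s → Pat s → Pat s
  φ ∨ₚ ψ = ¬ₚ (¬ₚ φ ∧ₚ ¬ₚ ψ)

  _⇒ₚ_ : ∀ {s} → Pat s → Pat s → Pat s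
  φ ⇒ₚ ψ = ¬ₚ φ ∨ₚ ψ

  _⇔ₚ_ : ∀ {s} → Pat s → Pat s → Pat s
  φ ⇔ₚ ψ = (φ ⇒ₚ ψ) ∧ₚ (ψ ⇒ₚ φ)

  ∀ₚ : ∀ {s} (t : S) → ℕ → Pat s → Pat s
  ∀ₚ t x φ = ¬ₚ (∃ₚ t x (¬ₚ φ))

  ⊤ₚ : (s : S) → Pat s
  ⊤ₚ s = ∃ₚ s 0 (var {s} 0)

  ⊥ₚ : (s : S) → Pat s
  ⊥ₚ s = ¬ₚ (⊤ₚ s)

  _≠ₚ_ : ∀ {s} → Pat s → Pat s → Pat pred
  φ ≠ₚ ψ = ¬ₚ (φ ≐ ψ)

  _∈ₚ_ : ∀ {s} → Pat s → Pat s → Pat pred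
  a ∈ₚ φ = (a ∨ₚ φ) ≐ φ

  sw : (α : NSort) {τ : S} → Pat (nm α) → Pat (nm α) → Pat τ → Pat τ
  sw α {τ} a a' x = app (swapS α τ) (a ∷ a' ∷ x ∷ [])

  fr : (α : NSort) (τ : S) → Pat (nm α) → Pat τ → Pat pred
  fr α τ a x = app (freshS α τ) (a ∷ x ∷ [])

  absP : (α : NSort) {τ : S} → Pat (nm α) → Pat τ → Pat (abst α τ)
  absP α {τ} a x = app (absS α τ) (a ∷ x ∷ [])

  -- fresh_{τ;α}(φ) := ∃ a:α. a ∧ ⌈ a # φ ⌉   (bound variable index 99;
  -- only applied below to variables with other indices)
  fresh : (α : NSort) (τ : S) → Pat τ → Pat (nm α)
  fresh α τ φ = ∃ₚ (nm α) 99 (var 99 ∧ₚ ⌈ fr α τ (var 99) φ ⌉)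

  vars : ℕ → (ss : List S) → Pats ss
  vars n [] = []
  vars n (s ∷ ss) = var n ∷ vars (suc n) ss

  swapAll : (α : NSort) → Pat (nm α) → Pat (nm α) → ∀ {ss} → Pats ss → Pats ss
  swapAll α a b [] = []
  swapAll α a b (φ ∷ φs) = sw α a b φ ∷ swapAll α a b φs

  Carrier : (S → Set) → S → Set
  Carrier c pred = ⊤
  Carrier c (nm α) = c (nm α)
  Carrier c (dt δ) = c (dt δ)
  Carrier c (abst α τ) = c (abst α τ)
  Carrier c (τ ⊗ τ') = c (τ ⊗ τ')

  Args : (S → Set) → List S → Set
  Args C [] = ⊤
  Args C (s ∷ ss) = C s × Args C ss

  record Model : Set₁ where
    field
      car      : S → Set
      nonempty : (s : S) → Carrier car s
      -- σ_M : M_τ₁ × … × M_τₙ → 𝒫(M_τ)  (subsets as predicates)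
      interp   : ∀ {ss s} → Sym ss s → Args (Carrier car) ss → Carrier car s → Set

  module Sem (M : Model) where
    open Model M

    Car : S → Set
    Car = Carrier car

    Val : Set
    Val = (s : S) → ℕ → Car s

    update : Val → (t : S) → ℕ → Car t → Val
    update ρ t x v s y with s ≟S t | y Nat.≟ x
    ... | yes refl | yes _ = v
    ... | _ | _ = ρ s y

    ⟦_⟧ : ∀ {s} → Pat s → Val → Car s → Set
    ⟦_⟧s : ∀ {ss} → Pats ss → Val → Args Car ss → Set

    ⟦ var {s} x ⟧ ρ m = m ≡ ρ s x
    ⟦ φ ∧ₚ ψ ⟧ ρ m = ⟦ φ ⟧ ρ m × ⟦ ψ ⟧ ρ m
    ⟦ ¬ₚ φ ⟧ ρ m = ¬ ⟦ φ ⟧ ρ m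
    ⟦ ∃ₚ t x φ ⟧ ρ m = Σ (Car t) λ v → ⟦ φ ⟧ (update ρ t x v) m
    ⟦ app {ss} σ φs ⟧ ρ m = Σ (Args Car ss) λ vs → ⟦ φs ⟧s ρ vs × interp σ vs m
    ⟦ ⌈ φ ⌉ ⟧ ρ m = ⟦ φ ⟧ ρ tt
    ⟦ _≐_ {s} φ ψ ⟧ ρ _ = (m : Car s) → (⟦ φ ⟧ ρ m → ⟦ ψ ⟧ ρ m) × (⟦ ψ ⟧ ρ m → ⟦ φ ⟧ ρ m)

    ⟦ [] ⟧s ρ _ = ⊤
    ⟦ φ ∷ φs ⟧s ρ (v , vs) = ⟦ φ ⟧ ρ v × ⟦ φs ⟧s ρ vs

  Valid : Model → ∀ {s} → Pat s → Set
  Valid M {s} φ = (ρ : Val) (m : Car s) → ⟦ φ ⟧ ρ m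
    where open Sem M

  AxSet : Set₁
  AxSet = (s : S) → Pat s → Set

  _⊨_ : Model → AxSet → Set
  M ⊨ A = ∀ {s} {φ : Pat s} → A s φ → Valid M φ

  _∪_ : AxSet → AxSet → AxSet
  (A ∪ B) s φ = A s φ ⊎ B s φ

  -- Free variables are implicitly universally quantified via
  -- validity.  Variable indices: names a,a',b = 0,1,2; x,x' (or y) = 10,11;
  -- symbol arguments = 20,21,… (all distinct within each axiom).

  a a' b : (α : NSort) → Pat (nm α)
  a α = var 0
  a' α = var 1
  b α = var 2

  x x' : (τ : S) → Pat τ
  x τ = var 10
  x' τ = var 11

  data AxCore : AxSet where
    S1  : ∀ α τ → AxCore pred (sw α (a α) (a α) (x τ) ≐ x τ)
    S2  : ∀ α τ → AxCore pred (sw α (a α) (a' α) (sw α (a α) (a' α) (x τ)) ≐ x τ)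
    S3  : ∀ α → AxCore pred (sw α (a α) (a' α) (a α) ≐ a' α)
    EV  : ∀ α {ss s} (σ : Sym ss s) →
          AxCore pred (sw α (a α) (b α) (app σ (vars 20 ss))
                        ≐ app σ (swapAll α (a α) (b α) (vars 20 ss)))
    P   : AxCore pred (∀ₚ pred 10 (x pred ≐ ⊤ₚ pred))
    A1  : ∀ α τ → AxCore pred
            ((absP α (a α) (x τ) ≐ absP α (a' α) (x' τ))
               ⇔ₚ ((a α ≐ a' α ∧ₚ x τ ≐ x' τ)
                   ∨ₚ (fr α τ (a α) (x' τ) ∧ₚ sw α (a α) (a' α) (x τ) ≐ x' τ)))
    A2  : ∀ α τ → AxCore pred
            (∀ₚ (abst α τ) 10 (∃ₚ (nm α) 0 (∃ₚ τ 11
              (x (abst α τ) ≐ absP α (a α) (x' τ)))))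
    Fun : ∀ {ss s} (σ : Sym ss s) → IsFunction σ →
          AxCore pred (∃ₚ s 10 (app σ (vars 20 ss) ≐ x s))

  data AxF : AxSet where
    F1 : ∀ α τ → AxF pred ((fr α τ (a α) (x τ) ∧ₚ fr α τ (a' α) (x τ))
                            ⇒ₚ (sw α (a α) (a' α) (x τ) ≐ x τ))
    F2 : ∀ α → AxF pred (fr α (nm α) (a α) (a' α) ⇔ₚ (a α ≠ₚ a' α))
    F3 : ∀ α α' → ¬ (α ≡ α') →
         AxF pred (∀ₚ (nm α) 0 (∀ₚ (nm α') 1 (fr α (nm α') (var 0) (var 1))))
    F4 : ∀ α τ → AxF pred (∀ₚ τ 10 (∃ₚ (nm α) 0 (fr α τ (a α) (x τ))))

  Ax-NLML : AxSet
  Ax-NLML = AxCore ∪ AxF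

  data AxF′ : AxSet where
    F1′ : ∀ α τ → AxF′ pred (sw α (fresh α τ (x τ)) (fresh α τ (x τ)) (x τ) ≐ x τ)
    F2′ : ∀ α → AxF′ pred (fresh α (nm α) (a α) ≐ ¬ₚ a α)
    F3′ : ∀ α α' → ¬ (α ≡ α') → AxF′ pred (fresh α' (nm α) (a α) ≐ ⊤ₚ (nm α'))
    F4′ : ∀ α τ → AxF′ pred (∀ₚ τ 10 (∃ₚ (nm α) 0 (a α ∈ₚ fresh α τ (x τ))))

{-# OPTIONS --safe #-}
module Submission where

-- Each of (F1)–(F4) and (F1′)–(F4′) is valid in a model exactly when a
-- first-order property of the interpretations of # and of swapping holds.
-- For (F2)/(F2′), (F3)/(F3′) and (F4)/(F4′) the two properties coincide:
-- fresh(a) denotes {m | m # a} and a ∈ fresh(x) says a # x.  Only (F1) and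
-- (F1′) differ.  (F1) gives (F1′) because any name u fresh for w, which
-- exists by (F4), satisfies (u u)·w = w by (F1) itself; (F1′) gives (F1)
-- because the swapping (u v)·w is inhabited by (Fun), and by (F1′) every
-- inhabitant is w.  Negation, ⇒ and ∀ are read classically, which is why
-- excluded middle is assumed.

open import Defs
open import Level using (0ℓ)
open import Axiom.ExcludedMiddle using (ExcludedMiddle)
open import Axiom.DoubleNegationElimination using (em⇒dne)
import Data.Nat as Nat
open import Data.Product using (Σ; _×_; _,_; proj₁; proj₂)
open import Data.Sum using (inj₂)
open import Data.Unit using (tt)
open import Function using (_∘_)
open import Function.Bundles using (_⇔_; mk⇔; Equivalence)
open import Function.Construct.Symmetry using (⇔-sym)
open import Function.Construct.Composition using (_⇔-∘_)
open import Function.Related.Propositional using (equivalence)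
open import Function.Related.TypeIsomorphisms using (¬-cong-⇔; Related-cong)
open import Relation.Nullary using (¬_; yes; no)
open import Relation.Nullary.Negation using (contradiction; ∀⟶¬∃¬)
open import Relation.Binary.PropositionalEquality
  using (_≡_; _≢_; refl; sym; trans; subst; subst₂; ≢-sym)

module Semantics (sig : Signature) (em : ExcludedMiddle 0ℓ) (M : NLML.Model sig) where
  open NLML sig
  open Model M
  open Sem M
  open Equivalence using (to; from)

  update-updates : ∀ ρ t i v → update ρ t i v t i ≡ v
  update-updates ρ t i v with t ≟S t | i Nat.≟ i
  ... | yes refl | yes _ = refl
  ... | yes refl | no i≢i = contradiction refl i≢i
  ... | no t≢t | _ = contradiction refl t≢t

  update-minimal : ∀ ρ t i v s j → j ≢ i → update ρ t i v s j ≡ ρ s j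
  update-minimal ρ t i v s j j≢i with s ≟S t | j Nat.≟ i
  ... | yes refl | yes j≡i = contradiction j≡i j≢i
  ... | yes refl | no _ = refl
  ... | no _ | _ = refl

  update-updates-under : ∀ ρ s i u t j v → i ≢ j → update (update ρ s i u) t j v s i ≡ u
  update-updates-under ρ s i u t j v i≢j =
    trans (update-minimal (update ρ s i u) t j v s i i≢j) (update-updates ρ s i u)

  ρ₀ : Val
  ρ₀ s _ = nonempty s

  instantiate₁ : ∀ {s i} (Q : Car s → Set) → ((ρ : Val) → Q (ρ s i)) → ∀ u → Q u
  instantiate₁ {s} {i} Q h u = subst Q (update-updates ρ₀ s i u) (h (update ρ₀ s i u))

  instantiate₂ : ∀ {s t i j} → i ≢ j → (Q : Car s → Car t → Set) →
                 ((ρ : Val) → Q (ρ s i) (ρ t j)) → ∀ u v → Q u v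
  instantiate₂ {s} {t} {i} {j} i≢j Q h u = instantiate₁ {i = j} (Q u) λ ρ →
    subst₂ Q (update-updates ρ s i u) (update-minimal ρ s i u t j (≢-sym i≢j))
      (h (update ρ s i u))

  instantiate₃ : ∀ {s t r i j k} → i ≢ j → i ≢ k → j ≢ k →
                 (Q : Car s → Car t → Car r → Set) →
                 ((ρ : Val) → Q (ρ s i) (ρ t j) (ρ r k)) → ∀ u v w → Q u v w
  instantiate₃ {s} {t} {r} {i} {j} {k} i≢j i≢k j≢k Q h u =
    instantiate₂ {i = j} {j = k} j≢k (Q u) λ ρ →
      subst₂ (Q u) (update-minimal ρ s i u t j (≢-sym i≢j))
                   (update-minimal ρ s i u r k (≢-sym i≢k))
        (subst (λ z → Q z (update ρ s i u t j) (update ρ s i u r k))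
               (update-updates ρ s i u) (h (update ρ s i u)))

  dne : {A : Set} → ¬ ¬ A → A
  dne = em⇒dne em

  ⟦∀ₚ⟧ : ∀ {s} t i (φ : Pat s) ρ {m} →
         ⟦ ∀ₚ t i φ ⟧ ρ m ⇔ ((v : Car t) → ⟦ φ ⟧ (update ρ t i v) m)
  ⟦∀ₚ⟧ _ _ _ _ = mk⇔ (λ h v → dne λ ¬φ → h (v , ¬φ)) ∀⟶¬∃¬

  ⟦⇒ₚ⟧ : ∀ {s} (φ ψ : Pat s) ρ {m} → ⟦ φ ⇒ₚ ψ ⟧ ρ m ⇔ (⟦ φ ⟧ ρ m → ⟦ ψ ⟧ ρ m)
  ⟦⇒ₚ⟧ _ _ _ = mk⇔ (λ h p → dne λ ¬q → h ((λ ¬p → ¬p p) , ¬q))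
                   (λ f (¬¬p , ¬q) → ¬¬p (¬q ∘ f))

  ⟦⇔ₚ⟧ : ∀ {s} (φ ψ : Pat s) ρ {m} → ⟦ φ ⇔ₚ ψ ⟧ ρ m ⇔ (⟦ φ ⟧ ρ m ⇔ ⟦ ψ ⟧ ρ m)
  ⟦⇔ₚ⟧ φ ψ ρ = mk⇔
    (λ (φ⇒ψ , ψ⇒φ) → mk⇔ (to (⟦⇒ₚ⟧ φ ψ ρ) φ⇒ψ) (to (⟦⇒ₚ⟧ ψ φ ρ) ψ⇒φ))
    (λ φ⇔ψ → from (⟦⇒ₚ⟧ φ ψ ρ) (to φ⇔ψ) , from (⟦⇒ₚ⟧ ψ φ ρ) (from φ⇔ψ))

  ⟦≐⟧ : ∀ {s} (φ ψ : Pat s) ρ → ⟦ φ ≐ ψ ⟧ ρ tt ⇔ (∀ m → ⟦ φ ⟧ ρ m ⇔ ⟦ ψ ⟧ ρ m)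
  ⟦≐⟧ _ _ _ = mk⇔ (λ h m → mk⇔ (proj₁ (h m)) (proj₂ (h m)))
                  (λ h m → to (h m) , from (h m))

  ⟦var≐var⟧ : ∀ {s} i j ρ → ⟦ var {s} i ≐ var j ⟧ ρ tt ⇔ (ρ s i ≡ ρ s j)
  ⟦var≐var⟧ _ _ _ = mk⇔ (λ h → proj₁ (h _) refl)
                        (λ e _ → (λ m≡ → trans m≡ e) , (λ m≡ → trans m≡ (sym e)))

  ⟦⊤ₚ⟧ : ∀ s ρ m → ⟦ ⊤ₚ s ⟧ ρ m
  ⟦⊤ₚ⟧ s ρ m = m , sym (update-updates ρ s 0 m)

  ⟦∈ₚ⟧ : ∀ {s} i (φ : Pat s) ρ → ⟦ var i ∈ₚ φ ⟧ ρ tt ⇔ ⟦ φ ⟧ ρ (ρ s i)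
  ⟦∈ₚ⟧ _ φ ρ = mk⇔ (λ h → proj₁ (h _) (λ (≢i , _) → ≢i refl))
    (λ φi _ → (λ ¬[≢×¬φ] → dne λ ¬φ → ¬[≢×¬φ] ((λ { refl → ¬φ φi }) , ¬φ))
            , (λ φm (_ , ¬φ) → ¬φ φm))

  -- Fr α τ u w is u # w, and Sw α τ u v w m is m ∈ (u v)·w.
  Fr : (α : NSort) (τ : S) → Car (nm α) → Car τ → Set
  Fr α τ u w = interp (freshS α τ) (u , w , tt) tt

  Sw : (α : NSort) (τ : S) → Car (nm α) → Car (nm α) → Car τ → Car τ → Set
  Sw α τ u v w = interp (swapS α τ) (u , v , w , tt)

  ⟦fr⟧ : ∀ {α τ} i j ρ {u w} → ρ (nm α) i ≡ u → ρ τ j ≡ w →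
         ⟦ fr α τ (var i) (var j) ⟧ ρ tt ⇔ Fr α τ u w
  ⟦fr⟧ _ _ _ refl refl = mk⇔ (λ { (_ , (refl , refl , _) , u#w) → u#w })
                             (λ u#w → _ , (refl , refl , tt) , u#w)

  ⟦sw⟧ : ∀ {α τ} i j k ρ {u v w m} → ρ (nm α) i ≡ u → ρ (nm α) j ≡ v → ρ τ k ≡ w →
         ⟦ sw α {τ} (var i) (var j) (var k) ⟧ ρ m ⇔ Sw α τ u v w m
  ⟦sw⟧ _ _ _ _ refl refl refl = mk⇔ (λ { (_ , (refl , refl , refl , _) , s) → s })
                                    (λ s → _ , (refl , refl , refl , tt) , s)

  ⟦fresh⟧ : ∀ {α τ} j ρ {w m} → j ≢ 99 → ρ τ j ≡ w →
            ⟦ fresh α τ (var j) ⟧ ρ m ⇔ Fr α τ m w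
  ⟦fresh⟧ {α} {τ} j ρ {m = m} j≢99 refl = mk⇔
    (λ (u , m≡u , m#w) → to (⟦fr⟧ 99 j (ρ[99≔ u ]) (sym m≡u) (kept u)) m#w)
    (λ m#w → m , sym (update-updates ρ (nm α) 99 m) ,
               from (⟦fr⟧ 99 j (ρ[99≔ m ]) (update-updates ρ (nm α) 99 m) (kept m)) m#w)
    where
    ρ[99≔_] : Car (nm α) → Val
    ρ[99≔ u ] = update ρ (nm α) 99 u
    kept : ∀ u → ρ[99≔ u ] τ j ≡ ρ τ j
    kept u = update-minimal ρ (nm α) 99 u τ j j≢99

  SwappingByFresh : (α : NSort) (τ : S) → Car τ → Car τ → Set
  SwappingByFresh α τ w m =
    Σ (Car (nm α)) λ u → Σ (Car (nm α)) λ v → Fr α τ u w × Fr α τ v w × Sw α τ u v w m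

  ⟦sw-fresh⟧ : ∀ {α τ} ρ {m} →
    ⟦ sw α (fresh α τ (x τ)) (fresh α τ (x τ)) (x τ) ⟧ ρ m ⇔ SwappingByFresh α τ (ρ τ 10) m
  ⟦sw-fresh⟧ {α} {τ} ρ = mk⇔
    (λ { ((u , v , _) , (u# , v# , refl , _) , s) → u , v , to x# u# , to x# v# , s })
    (λ (u , v , u# , v# , s) → (u , v , _ , tt) , (from x# u# , from x# v# , refl , tt) , s)
    where
    x# : ∀ {m} → ⟦ fresh α τ (x τ) ⟧ ρ m ⇔ Fr α τ m (ρ τ 10)
    x# = ⟦fresh⟧ 10 ρ (λ ()) refl

  FreshSwappingFixes : NSort → S → Set
  FreshSwappingFixes α τ =
    ∀ {u v w} → Fr α τ u w → Fr α τ v w → ∀ m → Sw α τ u v w m ⇔ (m ≡ w)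

  SwappingByFreshFixes : NSort → S → Set
  SwappingByFreshFixes α τ = ∀ w m → SwappingByFresh α τ w m ⇔ (m ≡ w)

  FreshIsApart : NSort → Set
  FreshIsApart α = ∀ u v → Fr α (nm α) u v ⇔ (u ≢ v)

  AllFresh : NSort → S → Set
  AllFresh α τ = ∀ u w → Fr α τ u w

  FreshExists : NSort → S → Set
  FreshExists α τ = ∀ w → Σ (Car (nm α)) λ u → Fr α τ u w

  SwappingTotal : NSort → S → Set
  SwappingTotal α τ = ∀ u v w → Σ (Car τ) (Sw α τ u v w)

  valid-F1 : ∀ α τ →
    Valid M ((fr α τ (a α) (x τ) ∧ₚ fr α τ (a' α) (x τ)) ⇒ₚ (sw α (a α) (a' α) (x τ) ≐ x τ))
      ⇔ FreshSwappingFixes α τ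
  valid-F1 α τ = mk⇔
    (λ valid {u} {v} {w} → instantiate₃ {nm α} {nm α} {τ} {0} {1} {10} (λ ()) (λ ()) (λ ())
       (λ u v w → Fr α τ u w → Fr α τ v w → ∀ m → Sw α τ u v w m ⇔ (m ≡ w))
       (λ ρ u# v# m → to (⟦≐⟧ swapped (x τ) ρ) (to (⟦⇒ₚ⟧ premise (swapped ≐ x τ) ρ) (valid ρ tt)
                        (from (fr₀ ρ) u# , from (fr₁ ρ) v#)) m ⇔-∘ ⇔-sym (sw₀₁ ρ))
       u v w)
    (λ fixes ρ _ → from (⟦⇒ₚ⟧ premise (swapped ≐ x τ) ρ) λ (u# , v#) →
       from (⟦≐⟧ swapped (x τ) ρ) λ m → fixes (to (fr₀ ρ) u#) (to (fr₁ ρ) v#) m ⇔-∘ sw₀₁ ρ)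
    where
    premise : Pat pred
    premise = fr α τ (a α) (x τ) ∧ₚ fr α τ (a' α) (x τ)
    swapped : Pat τ
    swapped = sw α (a α) (a' α) (x τ)
    fr₀ : ∀ ρ → ⟦ fr α τ (a α) (x τ) ⟧ ρ tt ⇔ Fr α τ (ρ (nm α) 0) (ρ τ 10)
    fr₀ ρ = ⟦fr⟧ 0 10 ρ refl refl
    fr₁ : ∀ ρ → ⟦ fr α τ (a' α) (x τ) ⟧ ρ tt ⇔ Fr α τ (ρ (nm α) 1) (ρ τ 10)
    fr₁ ρ = ⟦fr⟧ 1 10 ρ refl refl
    sw₀₁ : ∀ ρ {m} → ⟦ swapped ⟧ ρ m ⇔ Sw α τ (ρ (nm α) 0) (ρ (nm α) 1) (ρ τ 10) m
    sw₀₁ ρ = ⟦sw⟧ 0 1 10 ρ refl refl refl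

  valid-F1′ : ∀ α τ →
    Valid M (sw α (fresh α τ (x τ)) (fresh α τ (x τ)) (x τ) ≐ x τ) ⇔ SwappingByFreshFixes α τ
  valid-F1′ α τ = mk⇔
    (λ valid → instantiate₁ {τ} {10} (λ w → ∀ m → SwappingByFresh α τ w m ⇔ (m ≡ w)) λ ρ m →
       to (⟦≐⟧ swapped (x τ) ρ) (valid ρ tt) m ⇔-∘ ⇔-sym (⟦sw-fresh⟧ ρ))
    (λ fixes ρ _ → from (⟦≐⟧ swapped (x τ) ρ) λ m → fixes (ρ τ 10) m ⇔-∘ ⟦sw-fresh⟧ ρ)
    where
    swapped : Pat τ
    swapped = sw α (fresh α τ (x τ)) (fresh α τ (x τ)) (x τ)

  valid-F2 : ∀ α → Valid M (fr α (nm α) (a α) (a' α) ⇔ₚ (a α ≠ₚ a' α)) ⇔ FreshIsApart α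
  valid-F2 α = mk⇔
    (λ valid → instantiate₂ {nm α} {nm α} {0} {1} (λ ()) (λ u v → Fr α (nm α) u v ⇔ (u ≢ v))
                 λ ρ → to (at ρ) (valid ρ tt))
    (λ apart ρ _ → from (at ρ) (apart _ _))
    where
    at : ∀ ρ → ⟦ fr α (nm α) (a α) (a' α) ⇔ₚ (a α ≠ₚ a' α) ⟧ ρ tt
                 ⇔ (Fr α (nm α) (ρ (nm α) 0) (ρ (nm α) 1) ⇔ (ρ (nm α) 0 ≢ ρ (nm α) 1))
    at ρ = Related-cong {k = equivalence} (⟦fr⟧ 0 1 ρ refl refl) (¬-cong-⇔ (⟦var≐var⟧ 0 1 ρ))
             ⇔-∘ ⟦⇔ₚ⟧ (fr α (nm α) (a α) (a' α)) (a α ≠ₚ a' α) ρ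

  valid-F2′ : ∀ α → Valid M (fresh α (nm α) (a α) ≐ ¬ₚ a α) ⇔ FreshIsApart α
  valid-F2′ α = mk⇔
    (λ valid u v → instantiate₁ {nm α} {0} (λ v → ∀ u → Fr α (nm α) u v ⇔ (u ≢ v))
       (λ ρ u → to (⟦≐⟧ (fresh α (nm α) (a α)) (¬ₚ a α) ρ) (valid ρ tt) u ⇔-∘ ⇔-sym (a# ρ)) v u)
    (λ apart ρ _ → from (⟦≐⟧ (fresh α (nm α) (a α)) (¬ₚ a α) ρ) λ u → apart u _ ⇔-∘ a# ρ)
    where
    a# : ∀ ρ {m} → ⟦ fresh α (nm α) (a α) ⟧ ρ m ⇔ Fr α (nm α) m (ρ (nm α) 0)
    a# ρ = ⟦fresh⟧ 0 ρ (λ ()) refl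

  valid-F3 : ∀ α α' →
    Valid M (∀ₚ (nm α) 0 (∀ₚ (nm α') 1 (fr α (nm α') (var 0) (var 1)))) ⇔ AllFresh α (nm α')
  valid-F3 α α' = mk⇔
    (λ valid u v → to (at ρ₀ u v) (to (∀∀ ρ₀) (valid ρ₀ tt) u v))
    (λ all# ρ _ → from (∀∀ ρ) λ u v → from (at ρ u v) (all# u v))
    where
    φ : Pat pred
    φ = fr α (nm α') (var 0) (var 1)
    ∀∀ : ∀ ρ → ⟦ ∀ₚ (nm α) 0 (∀ₚ (nm α') 1 φ) ⟧ ρ tt
               ⇔ (∀ u v → ⟦ φ ⟧ (update (update ρ (nm α) 0 u) (nm α') 1 v) tt)
    ∀∀ ρ = mk⇔ (λ h u → to (⟦∀ₚ⟧ (nm α') 1 φ (update ρ (nm α) 0 u)) (h u))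
                (λ h u → from (⟦∀ₚ⟧ (nm α') 1 φ (update ρ (nm α) 0 u)) (h u))
           ⇔-∘ ⟦∀ₚ⟧ (nm α) 0 (∀ₚ (nm α') 1 φ) ρ
    at : ∀ ρ u v → ⟦ φ ⟧ (update (update ρ (nm α) 0 u) (nm α') 1 v) tt ⇔ Fr α (nm α') u v
    at ρ u v = ⟦fr⟧ 0 1 (update (update ρ (nm α) 0 u) (nm α') 1 v)
                 (update-updates-under ρ (nm α) 0 u (nm α') 1 v (λ ()))
                 (update-updates (update ρ (nm α) 0 u) (nm α') 1 v)

  valid-F3′ : ∀ α α' → Valid M (fresh α' (nm α) (a α) ≐ ⊤ₚ (nm α')) ⇔ AllFresh α' (nm α)
  valid-F3′ α α' = mk⇔
    (λ valid m u → instantiate₁ {nm α} {0} (λ u → ∀ m → Fr α' (nm α) m u)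
       (λ ρ m → to (a# ρ) (from (to (⟦≐⟧ φ (⊤ₚ (nm α')) ρ) (valid ρ tt) m) (⟦⊤ₚ⟧ (nm α') ρ m))) u m)
    (λ all# ρ _ → from (⟦≐⟧ φ (⊤ₚ (nm α')) ρ) λ m →
       mk⇔ (λ _ → ⟦⊤ₚ⟧ (nm α') ρ m) (λ _ → from (a# ρ) (all# m _)))
    where
    φ : Pat (nm α')
    φ = fresh α' (nm α) (a α)
    a# : ∀ ρ {m} → ⟦ φ ⟧ ρ m ⇔ Fr α' (nm α) m (ρ (nm α) 0)
    a# ρ = ⟦fresh⟧ 0 ρ (λ ()) refl

  valid-∀∃⇔FreshExists : ∀ {α τ} (φ : Pat pred) →
    (∀ ρ → ⟦ φ ⟧ ρ tt ⇔ Fr α τ (ρ (nm α) 0) (ρ τ 10)) →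
    Valid M (∀ₚ τ 10 (∃ₚ (nm α) 0 φ)) ⇔ FreshExists α τ
  valid-∀∃⇔FreshExists {α} {τ} φ φ⇔# = mk⇔
    (λ valid w → let (u , φu) = to (⟦∀ₚ⟧ τ 10 (∃ₚ (nm α) 0 φ) ρ₀) (valid ρ₀ tt) w
                 in u , to (at ρ₀ w u) φu)
    (λ exists ρ _ → from (⟦∀ₚ⟧ τ 10 (∃ₚ (nm α) 0 φ) ρ) λ w →
       let (u , u#w) = exists w in u , from (at ρ w u) u#w)
    where
    at : ∀ ρ w u → ⟦ φ ⟧ (update (update ρ τ 10 w) (nm α) 0 u) tt ⇔ Fr α τ u w
    at ρ w u = subst₂ (λ u' w' → ⟦ φ ⟧ ρ' tt ⇔ Fr α τ u' w')
                 (update-updates (update ρ τ 10 w) (nm α) 0 u)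
                 (update-updates-under ρ τ 10 w (nm α) 0 u (λ ()))
                 (φ⇔# ρ')
      where
      ρ' : Val
      ρ' = update (update ρ τ 10 w) (nm α) 0 u

  valid-F4 : ∀ α τ → Valid M (∀ₚ τ 10 (∃ₚ (nm α) 0 (fr α τ (a α) (x τ)))) ⇔ FreshExists α τ
  valid-F4 α τ = valid-∀∃⇔FreshExists (fr α τ (a α) (x τ)) λ ρ → ⟦fr⟧ 0 10 ρ refl refl

  valid-F4′ : ∀ α τ → Valid M (∀ₚ τ 10 (∃ₚ (nm α) 0 (a α ∈ₚ fresh α τ (x τ)))) ⇔ FreshExists α τ
  valid-F4′ α τ = valid-∀∃⇔FreshExists (a α ∈ₚ fresh α τ (x τ)) λ ρ →
    ⟦fresh⟧ 10 ρ (λ ()) refl ⇔-∘ ⟦∈ₚ⟧ 0 (fresh α τ (x τ)) ρ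

  valid-Fun⇒SwappingTotal : ∀ α τ →
    Valid M (∃ₚ τ 10 (sw α (var 20) (var 21) (var 22) ≐ x τ)) → SwappingTotal α τ
  valid-Fun⇒SwappingTotal α τ valid =
    instantiate₃ {nm α} {nm α} {τ} {20} {21} {22} (λ ()) (λ ()) (λ ())
      (λ u v w → Σ (Car τ) (Sw α τ u v w)) λ ρ →
        let (m , swapped≐m) = valid ρ tt in m , inhabitant ρ m swapped≐m
    where
    swapped : Pat τ
    swapped = sw α (var 20) (var 21) (var 22)
    inhabitant : ∀ ρ m → ⟦ swapped ≐ x τ ⟧ (update ρ τ 10 m) tt →
                 Sw α τ (ρ (nm α) 20) (ρ (nm α) 21) (ρ τ 22) m
    inhabitant ρ m swapped≐m =
      to (⟦sw⟧ 20 21 22 ρ' (kept (λ ())) (kept (λ ())) (kept (λ ())))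
         (from (to (⟦≐⟧ swapped (x τ) ρ') swapped≐m m) (sym (update-updates ρ τ 10 m)))
      where
      ρ' : Val
      ρ' = update ρ τ 10 m
      kept : ∀ {s i} → i ≢ 10 → ρ' s i ≡ ρ s i
      kept {s} {i} = update-minimal ρ τ 10 m s i

  freshSwappingFixes⇒swappingByFreshFixes : ∀ {α τ} →
    FreshSwappingFixes α τ → FreshExists α τ → SwappingByFreshFixes α τ
  freshSwappingFixes⇒swappingByFreshFixes fixes exists w m = mk⇔
    (λ (u , v , u# , v# , s) → to (fixes u# v# m) s)
    (λ { refl → let (u , u#) = exists w in u , u , u# , u# , from (fixes u# u# w) refl })

  swappingByFreshFixes⇒freshSwappingFixes : ∀ {α τ} →
    SwappingByFreshFixes α τ → SwappingTotal α τ → FreshSwappingFixes α τ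
  swappingByFreshFixes⇒freshSwappingFixes {α} {τ} fixes total {u} {v} {w} u# v# m =
    mk⇔ fixed λ { refl → let (m' , s) = total u v w in subst (Sw α τ u v w) (fixed s) s }
    where
    fixed : ∀ {m} → Sw α τ u v w m → m ≡ w
    fixed s = to (fixes w _) (u , v , u# , v# , s)

proposition3p4 : (sig : Signature) → ExcludedMiddle 0ℓ →
    let open NLML sig in
      ((M : Model) → M ⊨ Ax-NLML → M ⊨ AxF′)
      × ((M : Model) → M ⊨ AxCore → M ⊨ AxF′ → M ⊨ AxF)
proposition3p4 sig em = AxF⇒AxF′ , AxF′⇒AxF
  where
  open NLML sig

  module _ (M : Model) where
    open Semantics sig em M
    open Equivalence using (to; from)

    AxF⇒AxF′ : M ⊨ Ax-NLML → M ⊨ AxF′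
    AxF⇒AxF′ ⊨Ax (F1′ α τ) = from (valid-F1′ α τ) (freshSwappingFixes⇒swappingByFreshFixes
      (to (valid-F1 α τ) (⊨Ax (inj₂ (F1 α τ)))) (to (valid-F4 α τ) (⊨Ax (inj₂ (F4 α τ)))))
    AxF⇒AxF′ ⊨Ax (F2′ α) = from (valid-F2′ α) (to (valid-F2 α) (⊨Ax (inj₂ (F2 α))))
    AxF⇒AxF′ ⊨Ax (F3′ α α' α≢α') =
      from (valid-F3′ α α') (to (valid-F3 α' α) (⊨Ax (inj₂ (F3 α' α (≢-sym α≢α')))))
    AxF⇒AxF′ ⊨Ax (F4′ α τ) = from (valid-F4′ α τ) (to (valid-F4 α τ) (⊨Ax (inj₂ (F4 α τ))))

    AxF′⇒AxF : M ⊨ AxCore → M ⊨ AxF′ → M ⊨ AxF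
    AxF′⇒AxF ⊨Core ⊨F′ (F1 α τ) = from (valid-F1 α τ) (swappingByFreshFixes⇒freshSwappingFixes
      (to (valid-F1′ α τ) (⊨F′ (F1′ α τ)))
      (valid-Fun⇒SwappingTotal α τ (⊨Core (Fun (swapS α τ) (isSwap α τ)))))
    AxF′⇒AxF ⊨Core ⊨F′ (F2 α) = from (valid-F2 α) (to (valid-F2′ α) (⊨F′ (F2′ α)))
    AxF′⇒AxF ⊨Core ⊨F′ (F3 α α' α≢α') =
      from (valid-F3 α α') (to (valid-F3′ α' α) (⊨F′ (F3′ α' α (≢-sym α≢α'))))
    AxF′⇒AxF ⊨Core ⊨F′ (F4 α τ) = from (valid-F4 α τ) (to (valid-F4′ α τ) (⊨F′ (F4′ α τ)))
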